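{- Let $G$ be a finite simple graph of order $n$ and size $m$ with no isolated vertices, minimum degree $\delta$, maximum degree $\Delta$, and let $n_e$ be the number of vertices of $G$ of even degree. Then (i) $\gamma_{st}(G)\geq \dfrac{\left(\lfloor\frac{\delta}{2}\rfloor-\lceil\frac{\Delta}{2}\rceil+2\right)n}{\lfloor\frac{\delta}{2}\rfloor+\lceil\frac{\Delta}{2}\rceil}$; (ii) $\gamma_{st}(G)\geq \dfrac{\left(5-3\Delta-2\lceil\frac{\Delta}{2}\rceil\right)n+2n_e+8m}{3\Delta+2\lceil\frac{\Delta}{2}\rceil-1}$; (iii) $\gamma_{st}(G)\geq \dfrac{\left(5+3\delta-2\lceil\frac{\Delta}{2}\rceil\right)n+2n_e-4m}{3\delta+2\lceil\frac{\Delta}{2}\rceil-1}$; and these bounds are sharp (all three hold with equality for the cycle $C_n$).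
   Context: A signed total dominating function (STDF) of $G=(V,E)$ is a function $f:V\to\{ -1,1\}$ with $\sum_{u\in N(v)}f(u)\geq 1$ for every $v\in V$, where $N(v)$ is the open neighborhood of $v$; the signed total domination number $\gamma_{st}(G)$ is the minimum of $\sum_{v\in V}f(v)$ over all STDFs $f$ (an STDF exists precisely when $G$ has no isolated vertex). -}

module Defs where

open import Data.Bool using (Bool; true; false; T; _∨_; _∧_)
open import Data.Nat as ℕ using (ℕ; _≡ᵇ_; ⌊_/2⌋; ⌈_/2⌉; _%_)
open import Data.Fin using (Fin; toℕ)
open import Data.List using (List; length; filterᵇ; allFin; map; foldr; cartesianProduct)
open import Data.Integer as ℤ using (ℤ; +_; -[1+_]; 0ℤ)
open import Data.Product using (_×_; _,_; ∃; proj₁; proj₂)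
open import Data.Sum using (_⊎_)
open import Relation.Binary.PropositionalEquality using (_≡_; _≢_)

Graph : ℕ → Set
Graph n = Fin n → Fin n → Bool

IsSimple : ∀ {n} → Graph n → Set
IsSimple {n} G = (∀ (u v : Fin n) → G u v ≡ G v u) × (∀ (v : Fin n) → G v v ≡ false)

N : ∀ {n} → Graph n → Fin n → List (Fin n)
N {n} G v = filterᵇ (G v) (allFin n)

deg : ∀ {n} → Graph n → Fin n → ℕ
deg G v = length (N G v)

NoIsolated : ∀ {n} → Graph n → Set
NoIsolated {n} G = ∀ (v : Fin n) → 1 ℕ.≤ deg G v

IsMinDegree : ∀ {n} → Graph n → ℕ → Set
IsMinDegree {n} G δ = (∃ λ (v : Fin n) → deg G v ≡ δ) × (∀ (v : Fin n) → δ ℕ.≤ deg G v)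

IsMaxDegree : ∀ {n} → Graph n → ℕ → Set
IsMaxDegree {n} G Δ = (∃ λ (v : Fin n) → deg G v ≡ Δ) × (∀ (v : Fin n) → deg G v ℕ.≤ Δ)

-- size m: number of edges {u,v} (counted once, via toℕ u < toℕ v)
size : ∀ {n} → Graph n → ℕ
size {n} G = length (filterᵇ (λ p → G (proj₁ p) (proj₂ p) ∧ (toℕ (proj₁ p) ℕ.<ᵇ toℕ (proj₂ p)))
                            (cartesianProduct (allFin n) (allFin n)))

nEven : ∀ {n} → Graph n → ℕ
nEven {n} G = length (filterᵇ (λ v → (deg G v % 2) ≡ᵇ 0) (allFin n))

sumℤ : List ℤ → ℤ
sumℤ = foldr ℤ._+_ 0ℤ

IsSTDF : ∀ {n} → Graph n → (Fin n → ℤ) → Set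
IsSTDF {n} G f = (∀ (v : Fin n) → (f v ≡ + 1) ⊎ (f v ≡ -[1+ 0 ]))
               × (∀ (v : Fin n) → + 1 ℤ.≤ sumℤ (map f (N G v)))

weight : ∀ {n} → (Fin n → ℤ) → ℤ
weight {n} f = sumℤ (map f (allFin n))

IsγST : ∀ {n} → Graph n → ℤ → Set
IsγST G k = (∃ λ f → IsSTDF G f × weight f ≡ k) × (∀ f → IsSTDF G f → k ℤ.≤ weight f)

succAdj : (n : ℕ) → Fin n → Fin n → Bool
succAdj n i j = (ℕ.suc (toℕ i) ≡ᵇ toℕ j) ∨ ((ℕ.suc (toℕ i) ≡ᵇ n) ∧ (toℕ j ≡ᵇ 0))

cycle : (n : ℕ) → Graph n
cycle n i j = succAdj n i j ∨ succAdj n j i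

module Submission where

-- Fix an STDF f of a simple graph G; let P and M be its sets of +1 and -1 vertices, p = |P| and
-- q = |M|, so that p + q = n and weight f = p - q.  For a vertex v let pos v and neg v be the
-- numbers of its neighbours in P and in M; then deg v = pos v + neg v, and the STDF condition at v
-- says neg v < pos v.  Every edge between P and M is counted once in the sum of neg over P and once
-- in the sum of pos over M, so the two sums agree.  Hence a per-vertex inequality in which plus
-- vertices pay c · neg v and minus vertices receive c · pos v sums to a global inequality between
-- p, q, 2m = Σ deg and n_e ("discharging").  Each of the three bounds comes from one choice of
-- per-vertex inequalities, built from neg v < ⌈Δ/2⌉, ⌊δ/2⌋ < pos v and the parity refinement
-- neg v + 1 + [deg v even] ≤ pos v; a ring identity in ℤ then turns the global inequality into the
-- stated bound.  On the cycle C_n every degree is 2, so the all-ones function is an STDF of weight n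
-- and bound (i) gives γ ≥ n, while n_e = m = n make all three bounds equalities.

open import Defs
open import Data.Nat using (ℕ)
open import Data.Fin using (Fin)
open import Data.Integer using (ℤ)

module Sums where

  open import Data.Nat using (ℕ; suc; _+_; _*_; _≤_; z≤n)
  open import Data.Nat.Properties using (+-mono-≤; *-zeroʳ; *-distribˡ-+; +-assoc; +-identityʳ; *-identityʳ)
  open import Data.Nat.Tactic.RingSolver using (solve-∀)
  open import Data.Bool using (Bool; true; false; not)
  open import Data.List using (List; []; _∷_; length; filterᵇ; map; _++_; cartesianProduct; allFin)
  open import Data.List.Properties using (map-tabulate; length-tabulate)
  open import Data.Fin as Fin using (Fin)
  open import Data.Product using (_×_; _,_)
  open import Function using (id)
  open import Relation.Binary.PropositionalEquality

  ⟦_⟧ : Bool → ℕ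
  ⟦ true ⟧ = 1
  ⟦ false ⟧ = 0

  ∑ : ∀ {A : Set} → List A → (A → ℕ) → ℕ
  ∑ [] g = 0
  ∑ (x ∷ xs) g = g x + ∑ xs g

  ∑-cong : ∀ {A : Set} (xs : List A) {g h : A → ℕ} → (∀ x → g x ≡ h x) → ∑ xs g ≡ ∑ xs h
  ∑-cong [] _ = refl
  ∑-cong (x ∷ xs) g≡h = cong₂ _+_ (g≡h x) (∑-cong xs g≡h)

  ∑-mono : ∀ {A : Set} (xs : List A) {g h : A → ℕ} → (∀ x → g x ≤ h x) → ∑ xs g ≤ ∑ xs h
  ∑-mono [] _ = z≤n
  ∑-mono (x ∷ xs) g≤h = +-mono-≤ (g≤h x) (∑-mono xs g≤h)

  ∑-zero : ∀ {A : Set} (xs : List A) → ∑ xs (λ _ → 0) ≡ 0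
  ∑-zero [] = refl
  ∑-zero (_ ∷ xs) = ∑-zero xs

  ∑-+ : ∀ {A : Set} (xs : List A) (g h : A → ℕ) → ∑ xs (λ x → g x + h x) ≡ ∑ xs g + ∑ xs h
  ∑-+ [] _ _ = refl
  ∑-+ (x ∷ xs) g h = trans (cong (g x + h x +_) (∑-+ xs g h)) (interchange (g x) (h x) _ _)
    where
      interchange : ∀ a b c d → (a + b) + (c + d) ≡ (a + c) + (b + d)
      interchange = solve-∀

  ∑-* : ∀ {A : Set} (xs : List A) (k : ℕ) (g : A → ℕ) → ∑ xs (λ x → k * g x) ≡ k * ∑ xs g
  ∑-* [] k _ = sym (*-zeroʳ k)
  ∑-* (x ∷ xs) k g = trans (cong (k * g x +_) (∑-* xs k g)) (sym (*-distribˡ-+ k (g x) _))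

  ∑-+* : ∀ {A : Set} (xs : List A) (g : A → ℕ) (k : ℕ) (h : A → ℕ) →
    ∑ xs (λ x → g x + k * h x) ≡ ∑ xs g + k * ∑ xs h
  ∑-+* xs g k h = trans (∑-+ xs g (λ x → k * h x)) (cong (∑ xs g +_) (∑-* xs k h))

  ∑-swap : ∀ {A B : Set} (xs : List A) (ys : List B) (h : A → B → ℕ) →
    ∑ xs (λ x → ∑ ys (h x)) ≡ ∑ ys (λ y → ∑ xs (λ x → h x y))
  ∑-swap [] ys h = sym (∑-zero ys)
  ∑-swap (x ∷ xs) ys h =
    trans (cong (∑ ys (h x) +_) (∑-swap xs ys h)) (sym (∑-+ ys (h x) (λ y → ∑ xs (λ x′ → h x′ y))))

  ∑-++ : ∀ {A : Set} (xs ys : List A) (g : A → ℕ) → ∑ (xs ++ ys) g ≡ ∑ xs g + ∑ ys g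
  ∑-++ [] ys g = refl
  ∑-++ (x ∷ xs) ys g = trans (cong (g x +_) (∑-++ xs ys g)) (sym (+-assoc (g x) _ _))

  ∑-map : ∀ {A B : Set} (h : A → B) (xs : List A) (g : B → ℕ) → ∑ (map h xs) g ≡ ∑ xs (λ x → g (h x))
  ∑-map h [] g = refl
  ∑-map h (x ∷ xs) g = cong (g (h x) +_) (∑-map h xs g)

  ∑-cartesian : ∀ {A B : Set} (xs : List A) (ys : List B) (g : A × B → ℕ) →
    ∑ (cartesianProduct xs ys) g ≡ ∑ xs (λ x → ∑ ys (λ y → g (x , y)))
  ∑-cartesian [] ys g = refl
  ∑-cartesian (x ∷ xs) ys g = trans (∑-++ (map (x ,_) ys) (cartesianProduct xs ys) g)
    (cong₂ _+_ (∑-map (x ,_) ys g) (∑-cartesian xs ys g))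

  ∑-filter : ∀ {A : Set} (b : A → Bool) (xs : List A) (g : A → ℕ) →
    ∑ (filterᵇ b xs) g ≡ ∑ xs (λ x → ⟦ b x ⟧ * g x)
  ∑-filter b [] g = refl
  ∑-filter b (x ∷ xs) g with b x
  ... | true = cong₂ _+_ (sym (+-identityʳ (g x))) (∑-filter b xs g)
  ... | false = ∑-filter b xs g

  length≡∑1 : ∀ {A : Set} (xs : List A) → length xs ≡ ∑ xs (λ _ → 1)
  length≡∑1 [] = refl
  length≡∑1 (_ ∷ xs) = cong suc (length≡∑1 xs)

  length-filter : ∀ {A : Set} (b : A → Bool) (xs : List A) → length (filterᵇ b xs) ≡ ∑ xs (λ x → ⟦ b x ⟧)
  length-filter b xs = trans (length≡∑1 (filterᵇ b xs))
    (trans (∑-filter b xs (λ _ → 1)) (∑-cong xs (λ x → *-identityʳ ⟦ b x ⟧)))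

  length-partition : ∀ {A : Set} (b : A → Bool) (xs : List A) →
    length xs ≡ ∑ xs (λ x → ⟦ b x ⟧) + ∑ xs (λ x → ⟦ not (b x) ⟧)
  length-partition b xs = trans (length≡∑1 xs)
    (trans (∑-cong xs (λ x → sym (one-of (b x)))) (∑-+ xs (λ x → ⟦ b x ⟧) (λ x → ⟦ not (b x) ⟧)))
    where
      one-of : ∀ β → ⟦ β ⟧ + ⟦ not β ⟧ ≡ 1
      one-of true = refl
      one-of false = refl

  length-allFin : ∀ n → length (allFin n) ≡ n
  length-allFin n = length-tabulate id

  ∑-allFin-suc : ∀ n (g : Fin (suc n) → ℕ) →
    ∑ (allFin (suc n)) g ≡ g Fin.zero + ∑ (allFin n) (λ i → g (Fin.suc i))
  ∑-allFin-suc n g = cong (g Fin.zero +_)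
    (trans (cong (λ xs → ∑ xs g) (sym (map-tabulate id Fin.suc))) (∑-map Fin.suc (allFin n) g))

open Sums

module Handshake {n : ℕ} (G : Graph n) (simple : IsSimple G) where

  open import Data.Nat using (ℕ; _+_; _*_; _<_; _<ᵇ_)
  open import Data.Nat.Properties using (<-cmp; <⇒<ᵇ; <ᵇ⇒<; +-identityʳ)
  open import Data.Bool using (true; false; _∧_; T)
  open import Data.Unit using (tt)
  open import Data.List using (List; allFin; cartesianProduct)
  open import Data.Fin as Fin using (Fin; toℕ)
  open import Data.Fin.Properties using (toℕ-injective)
  open import Data.Product using (proj₁; proj₂)
  open import Relation.Binary using (tri<; tri≈; tri>)
  open import Relation.Nullary using (¬_; yes; no; contradiction)
  open import Relation.Binary.PropositionalEquality

  <ᵇ-true : ∀ {x y} → x < y → (x <ᵇ y) ≡ true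
  <ᵇ-true {x} {y} x<y with x <ᵇ y | <⇒<ᵇ x<y
  ... | true | _ = refl

  <ᵇ-false : ∀ {x y} → ¬ x < y → (x <ᵇ y) ≡ false
  <ᵇ-false {x} {y} x≮y with x <ᵇ y in eq
  ... | true = contradiction (<ᵇ⇒< x y (subst T (sym eq) tt)) x≮y
  ... | false = refl

  split-by-order : ∀ β {x y} → x ≢ y → ⟦ β ⟧ ≡ ⟦ β ∧ (x <ᵇ y) ⟧ + ⟦ β ∧ (y <ᵇ x) ⟧
  split-by-order false _ = refl
  split-by-order true {x} {y} x≢y with <-cmp x y
  ... | tri< x<y _ y≮x rewrite <ᵇ-true x<y | <ᵇ-false y≮x = refl
  ... | tri≈ _ x≡y _ = contradiction x≡y x≢y
  ... | tri> x≮y _ y<x rewrite <ᵇ-false x≮y | <ᵇ-true y<x = refl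

  -- The edge uv is recorded at its endpoint of smaller index; this is how size counts it.
  before : Fin n → Fin n → ℕ
  before u v = ⟦ G u v ∧ (toℕ u <ᵇ toℕ v) ⟧

  size≡∑before : size G ≡ ∑ (allFin n) (λ u → ∑ (allFin n) (before u))
  size≡∑before = trans (length-filter _ (cartesianProduct (allFin n) (allFin n))) (∑-cartesian (allFin n) (allFin n) _)

  edge-counted-once : ∀ u v → ⟦ G u v ⟧ ≡ before u v + before v u
  edge-counted-once u v with u Fin.≟ v
  ... | yes refl rewrite proj₂ simple u = refl
  ... | no u≢v rewrite proj₁ simple v u = split-by-order (G u v) (λ eq → u≢v (toℕ-injective eq))

  deg≡∑ : ∀ v → deg G v ≡ ∑ (allFin n) (λ u → ⟦ G v u ⟧)
  deg≡∑ v = length-filter (G v) (allFin n)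

  handshake : ∑ (allFin n) (deg G) ≡ 2 * size G
  handshake = begin
      ∑ vs (deg G)
    ≡⟨ ∑-cong vs (λ u → trans (deg≡∑ u) (∑-cong vs (edge-counted-once u))) ⟩
      ∑ vs (λ u → ∑ vs (λ v → before u v + before v u))
    ≡⟨ ∑-cong vs (λ u → ∑-+ vs (before u) (λ v → before v u)) ⟩
      ∑ vs (λ u → ∑ vs (before u) + ∑ vs (λ v → before v u))
    ≡⟨ ∑-+ vs (λ u → ∑ vs (before u)) (λ u → ∑ vs (λ v → before v u)) ⟩
      ∑ vs (λ u → ∑ vs (before u)) + ∑ vs (λ u → ∑ vs (λ v → before v u))
    ≡⟨ cong₂ _+_ (sym size≡∑before) (trans (∑-swap vs vs (λ u v → before v u)) (sym size≡∑before)) ⟩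
      size G + size G
    ≡⟨ cong (size G +_) (sym (+-identityʳ (size G))) ⟩
      2 * size G ∎
    where
      open ≡-Reasoning
      vs : List (Fin n)
      vs = allFin n

module Arithmetic where

  open import Data.Nat using (ℕ; suc; _+_; _*_; _≤_; _<_; z≤n; ⌊_/2⌋; ⌈_/2⌉; _%_; _≡ᵇ_)
  open import Data.Nat.Properties
  open import Data.Nat.DivMod using ([m+kn]%n≡m%n)
  open import Data.Nat.Tactic.RingSolver using (solve-∀)
  open import Data.Bool using (true; false; not)
  open import Data.Sum using (inj₁; inj₂)
  open import Relation.Binary.PropositionalEquality

  ≤-by-certificate : ∀ {l r x y} s → x ≤ y → l + y + s ≡ r + x → l ≤ r
  ≤-by-certificate {l} {r} {x} {y} s x≤y eq = +-cancelʳ-≤ x l r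
    (≤-trans (+-monoʳ-≤ l x≤y) (≤-trans (m≤m+n (l + y) s) (≤-reflexive eq)))

  <⌈/2⌉ : ∀ {k Δ} → suc (k + k) ≤ Δ → k < ⌈ Δ /2⌉
  <⌈/2⌉ {k} {Δ} h = subst (_≤ ⌈ Δ /2⌉) (cong suc (sym (n≡⌊n+n/2⌋ k))) (⌈n/2⌉-mono h)

  ⌊/2⌋< : ∀ {δ k} → δ < k + k → ⌊ δ /2⌋ < k
  ⌊/2⌋< {δ} {k} δ<2k = ≰⇒> (λ k≤a → <⇒≱ (≤-<-trans twice-floor δ<2k) (+-mono-≤ k≤a k≤a))
    where
      twice-floor : ⌊ δ /2⌋ + ⌊ δ /2⌋ ≤ δ
      twice-floor = ≤-trans (+-monoʳ-≤ ⌊ δ /2⌋ (⌊n/2⌋≤⌈n/2⌉ δ)) (≤-reflexive (⌊n/2⌋+⌈n/2⌉≡n δ))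

  ev : ℕ → ℕ
  ev d = ⟦ d % 2 ≡ᵇ 0 ⟧

  ev≤1 : ∀ d → ev d ≤ 1
  ev≤1 d with d % 2 ≡ᵇ 0
  ... | true = ≤-refl
  ... | false = z≤n

  ev-odd : ∀ k → ev (suc k + k) ≡ 0
  ev-odd k = trans (cong ev (odd-form k)) (cong (λ r → ⟦ r ≡ᵇ 0 ⟧) ([m+kn]%n≡m%n 1 k 2))
    where
      odd-form : ∀ k → suc k + k ≡ 1 + k * 2
      odd-form = solve-∀

  parity-gap : ∀ {pos neg} → neg < pos → neg + 1 + ev (pos + neg) ≤ pos
  parity-gap {pos} {neg} neg<pos with m≤n⇒m<n∨m≡n neg<pos
  ... | inj₂ refl rewrite ev-odd neg = ≤-reflexive (trans (+-identityʳ (neg + 1)) (+-comm neg 1))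
  ... | inj₁ neg+2≤pos = ≤-trans (+-monoʳ-≤ (neg + 1) (ev≤1 (pos + neg)))
                                 (subst (_≤ pos) (trans (+-comm 2 neg) (sym (+-assoc neg 1 1))) neg+2≤pos)

  -- A pair of local inequalities, one for each sign β of a vertex, combined into a single
  -- inequality weighted by the indicators ⟦ β ⟧ and ⟦ not β ⟧ so that it can be summed.
  by-sign : ∀ β {a b kp kq lp c x y : ℕ}
    → (β ≡ true → a + kp + c * x ≤ b + lp)
    → (β ≡ false → a + kq ≤ b + c * y)
    → a + kp * ⟦ β ⟧ + kq * ⟦ not β ⟧ + c * (⟦ β ⟧ * x) ≤ b + lp * ⟦ β ⟧ + c * (⟦ not β ⟧ * y)
  by-sign true {a} {b} {kp} {kq} {lp} {c} {x} {y} plus _ =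
    subst₂ _≤_ (plus-left a kp kq c x) (plus-right b lp c y) (plus refl)
    where
      plus-left : ∀ a kp kq c x → a + kp + c * x ≡ a + kp * 1 + kq * 0 + c * (1 * x)
      plus-left = solve-∀
      plus-right : ∀ b lp c y → b + lp ≡ b + lp * 1 + c * (0 * y)
      plus-right = solve-∀
  by-sign false {a} {b} {kp} {kq} {lp} {c} {x} {y} _ minus =
    subst₂ _≤_ (minus-left a kp kq c x) (minus-right b lp c y) (minus refl)
    where
      minus-left : ∀ a kp kq c x → a + kq ≡ a + kp * 0 + kq * 1 + c * (0 * x)
      minus-left = solve-∀
      minus-right : ∀ b lp c y → b + c * y ≡ b + lp * 0 + c * (1 * y)
      minus-right = solve-∀

  -- The local inequalities behind bound (ii), at a vertex of degree d = pos + neg whose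
  -- parity indicator is e; the plus case uses d ≤ Δ and neg < b, the minus case nothing more.
  plus₂ : ∀ {d e pos neg Δ b} → d ≡ pos + neg → neg + 1 + e ≤ pos → d ≤ Δ → neg < b →
    2 * d + e + 3 + 4 * neg ≤ 3 * Δ + 2 * b
  plus₂ {e = e} {pos} {neg} {Δ} {b} refl gap d≤Δ neg<b =
    ≤-by-certificate 0 (+-mono-≤ (+-mono-≤ (*-monoʳ-≤ 3 d≤Δ) (*-monoʳ-≤ 2 neg<b)) gap) (identity e pos neg Δ b)
    where
      identity : ∀ e pos neg Δ b → 2 * (pos + neg) + e + 3 + 4 * neg + (3 * Δ + 2 * b + pos) + 0
        ≡ 3 * Δ + 2 * b + (3 * (pos + neg) + 2 * (1 + neg) + (neg + 1 + e))
      identity = solve-∀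

  minus₂ : ∀ {d e pos neg} → d ≡ pos + neg → neg + 1 + e ≤ pos → 2 * d + e + 2 ≤ 4 * pos
  minus₂ {e = e} {pos} {neg} refl gap = ≤-by-certificate e (*-monoʳ-≤ 2 gap) (identity e pos neg)
    where
      identity : ∀ e pos neg → 2 * (pos + neg) + e + 2 + 2 * pos + e ≡ 4 * pos + 2 * (neg + 1 + e)
      identity = solve-∀

  -- The local inequalities behind bound (iii); the minus case uses δ ≤ d.
  plus₃ : ∀ {d e pos neg b} → d ≡ pos + neg → neg + 1 + e ≤ pos → neg < b → e + 3 + 4 * neg ≤ d + 2 * b
  plus₃ {e = e} {pos} {neg} {b} refl gap neg<b =
    ≤-by-certificate 0 (+-mono-≤ gap (*-monoʳ-≤ 2 neg<b)) (identity e pos neg b)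
    where
      identity : ∀ e pos neg b → e + 3 + 4 * neg + (pos + 2 * b) + 0 ≡ pos + neg + 2 * b + (neg + 1 + e + 2 * (1 + neg))
      identity = solve-∀

  minus₃ : ∀ {d e pos neg δ} → d ≡ pos + neg → neg + 1 + e ≤ pos → δ ≤ d → e + (3 * δ + 2) ≤ d + 4 * pos
  minus₃ {e = e} {pos} {neg} {δ} refl gap δ≤d =
    ≤-by-certificate e (+-mono-≤ (*-monoʳ-≤ 3 δ≤d) (*-monoʳ-≤ 2 gap)) (identity e pos neg δ)
    where
      identity : ∀ e pos neg δ → e + (3 * δ + 2) + (3 * (pos + neg) + 2 * pos) + e
        ≡ pos + neg + 4 * pos + (3 * δ + 2 * (neg + 1 + e))
      identity = solve-∀

module Rearrangement where

  import Data.Nat as ℕ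
  open import Data.Nat using (ℕ; ⌊_/2⌋; ⌈_/2⌉)
  open import Data.Integer using (ℤ; +_; _+_; _-_; _*_; _≤_; +≤+)
  open import Data.Integer.Properties using (pos-*; +-monoˡ-≤; +-mono-≤; module ≤-Reasoning)
  open import Data.Integer.Tactic.RingSolver using (solve-∀)
  open import Relation.Binary.PropositionalEquality using (_≡_; refl; cong; cong₂; trans)

  Bound₁ : (n δ Δ : ℕ) (γ : ℤ) → Set
  Bound₁ n δ Δ γ = (+ ⌊ δ /2⌋ - + ⌈ Δ /2⌉ + + 2) * + n ≤ γ * + (⌊ δ /2⌋ ℕ.+ ⌈ Δ /2⌉)

  Bound₂ : (n Δ nₑ m : ℕ) (γ : ℤ) → Set
  Bound₂ n Δ nₑ m γ = (+ 5 - + 3 * + Δ - + 2 * + ⌈ Δ /2⌉) * + n + + 2 * + nₑ + + 8 * + m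
                      ≤ γ * (+ 3 * + Δ + + 2 * + ⌈ Δ /2⌉ - + 1)

  Bound₃ : (n δ Δ nₑ m : ℕ) (γ : ℤ) → Set
  Bound₃ n δ Δ nₑ m γ = (+ 5 + + 3 * + δ - + 2 * + ⌈ Δ /2⌉) * + n + + 2 * + nₑ - + 4 * + m
                        ≤ γ * (+ 3 * + δ + + 2 * + ⌈ Δ /2⌉ - + 1)

  doubled-gap : ∀ {X Y L R : ℤ} → X ≤ Y → L + (Y + Y) ≡ R + (X + X) → L ≤ R
  doubled-gap {X} {Y} {L} {R} X≤Y eq = begin
      L                         ≡⟨ split-off L (X + X) ⟩
      (X + X) + (L - (X + X))   ≤⟨ +-monoˡ-≤ (L - (X + X)) (+-mono-≤ X≤Y X≤Y) ⟩
      (Y + Y) + (L - (X + X))   ≡⟨ regroup (Y + Y) L (X + X) ⟩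
      (L + (Y + Y)) - (X + X)   ≡⟨ cong (_- (X + X)) eq ⟩
      (R + (X + X)) - (X + X)   ≡⟨ cancel R (X + X) ⟩
      R                         ∎
    where
      open ≤-Reasoning
      split-off : ∀ L Z → L ≡ Z + (L - Z)
      split-off = solve-∀
      regroup : ∀ W L Z → W + (L - Z) ≡ (L + W) - Z
      regroup = solve-∀
      cancel : ∀ R Z → (R + Z) - Z ≡ R
      cancel = solve-∀

  cast-≤ : ∀ {x y : ℕ} {X Y : ℤ} → x ℕ.≤ y → + x ≡ X → + y ≡ Y → X ≤ Y
  cast-≤ h refl refl = +≤+ h

  -- Each bound below: a counting inequality in p = |P|, q = |M| yields the bound for
  -- γ = p - q and n = p + q; the certificate is a ring identity of the doubled-gap form.
  bound₁ : ∀ {a b p q n : ℕ} {γ : ℤ} → p ℕ.+ q ≡ n → γ ≡ + p - + q →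
    1 ℕ.* p ℕ.+ (1 ℕ.+ a) ℕ.* q ℕ.≤ b ℕ.* p → (+ a - + b + + 2) * + n ≤ γ * + (a ℕ.+ b)
  bound₁ {a} {b} {p} {q} refl refl h =
    doubled-gap (cast-≤ h (cong₂ _+_ (pos-* 1 p) (pos-* (1 ℕ.+ a) q)) (pos-* b p)) (identity (+ a) (+ b) (+ p) (+ q))
    where
      identity : ∀ a b p q → (a - b + + 2) * (p + q) + (b * p + b * p)
        ≡ (p - q) * (a + b) + ((+ 1 * p + (+ 1 + a) * q) + (+ 1 * p + (+ 1 + a) * q))
      identity = solve-∀

  bound₂ : ∀ {Δ b p q m nₑ n : ℕ} {γ : ℤ} → p ℕ.+ q ≡ n → γ ≡ + p - + q →
    2 ℕ.* (2 ℕ.* m) ℕ.+ nₑ ℕ.+ 3 ℕ.* p ℕ.+ 2 ℕ.* q ℕ.≤ (3 ℕ.* Δ ℕ.+ 2 ℕ.* b) ℕ.* p →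
    (+ 5 - + 3 * + Δ - + 2 * + b) * + n + + 2 * + nₑ + + 8 * + m ≤ γ * (+ 3 * + Δ + + 2 * + b - + 1)
  bound₂ {Δ} {b} {p} {q} {m} {nₑ} refl refl h =
    doubled-gap (cast-≤ h castˡ castʳ) (identity (+ Δ) (+ b) (+ p) (+ q) (+ m) (+ nₑ))
    where
      castˡ : + (2 ℕ.* (2 ℕ.* m) ℕ.+ nₑ ℕ.+ 3 ℕ.* p ℕ.+ 2 ℕ.* q) ≡ + 2 * (+ 2 * + m) + + nₑ + + 3 * + p + + 2 * + q
      castˡ = cong₂ _+_ (cong₂ _+_ (cong (_+ + nₑ) (trans (pos-* 2 (2 ℕ.* m)) (cong (+ 2 *_) (pos-* 2 m)))) (pos-* 3 p))
                        (pos-* 2 q)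
      castʳ : + ((3 ℕ.* Δ ℕ.+ 2 ℕ.* b) ℕ.* p) ≡ (+ 3 * + Δ + + 2 * + b) * + p
      castʳ = trans (pos-* (3 ℕ.* Δ ℕ.+ 2 ℕ.* b) p) (cong (_* + p) (cong₂ _+_ (pos-* 3 Δ) (pos-* 2 b)))
      identity : ∀ Δ b p q m nₑ → (+ 5 - + 3 * Δ - + 2 * b) * (p + q) + + 2 * nₑ + + 8 * m
          + ((+ 3 * Δ + + 2 * b) * p + (+ 3 * Δ + + 2 * b) * p)
        ≡ (p - q) * (+ 3 * Δ + + 2 * b - + 1)
          + ((+ 2 * (+ 2 * m) + nₑ + + 3 * p + + 2 * q) + (+ 2 * (+ 2 * m) + nₑ + + 3 * p + + 2 * q))
      identity = solve-∀

  bound₃ : ∀ {δ b p q m nₑ n : ℕ} {γ : ℤ} → p ℕ.+ q ≡ n → γ ≡ + p - + q →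
    nₑ ℕ.+ 3 ℕ.* p ℕ.+ (3 ℕ.* δ ℕ.+ 2) ℕ.* q ℕ.≤ 2 ℕ.* m ℕ.+ 2 ℕ.* b ℕ.* p →
    (+ 5 + + 3 * + δ - + 2 * + b) * + n + + 2 * + nₑ - + 4 * + m ≤ γ * (+ 3 * + δ + + 2 * + b - + 1)
  bound₃ {δ} {b} {p} {q} {m} {nₑ} refl refl h =
    doubled-gap (cast-≤ h castˡ castʳ) (identity (+ δ) (+ b) (+ p) (+ q) (+ m) (+ nₑ))
    where
      castˡ : + (nₑ ℕ.+ 3 ℕ.* p ℕ.+ (3 ℕ.* δ ℕ.+ 2) ℕ.* q) ≡ + nₑ + + 3 * + p + (+ 3 * + δ + + 2) * + q
      castˡ = cong₂ _+_ (cong (_+_ (+ nₑ)) (pos-* 3 p))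
                        (trans (pos-* (3 ℕ.* δ ℕ.+ 2) q) (cong (λ t → (t + + 2) * + q) (pos-* 3 δ)))
      castʳ : + (2 ℕ.* m ℕ.+ 2 ℕ.* b ℕ.* p) ≡ + 2 * + m + + 2 * + b * + p
      castʳ = cong₂ _+_ (pos-* 2 m) (trans (pos-* (2 ℕ.* b) p) (cong (_* + p) (pos-* 2 b)))
      identity : ∀ δ b p q m nₑ → (+ 5 + + 3 * δ - + 2 * b) * (p + q) + + 2 * nₑ - + 4 * m
          + ((+ 2 * m + + 2 * b * p) + (+ 2 * m + + 2 * b * p))
        ≡ (p - q) * (+ 3 * δ + + 2 * b - + 1)
          + ((nₑ + + 3 * p + (+ 3 * δ + + 2) * q) + (nₑ + + 3 * p + (+ 3 * δ + + 2) * q))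
      identity = solve-∀

module Signs where

  open import Data.Integer as ℤ using (ℤ; +_; -[1+_])
  open import Data.Integer.Tactic.RingSolver using (solve-∀)
  open import Data.Bool using (Bool; true; false; not)
  open import Data.List using ([]; _∷_; map)
  open import Data.Sum using (_⊎_; inj₁; inj₂)
  open import Relation.Binary.PropositionalEquality

  -- Whether an integer is non-negative; on ±1 values it tells +1 from -1.
  isPlus : ℤ → Bool
  isPlus (+ _) = true
  isPlus -[1+ _ ] = false

  signed-sum : ∀ {A : Set} (g : A → ℤ) → (∀ x → (g x ≡ + 1) ⊎ (g x ≡ -[1+ 0 ])) → ∀ xs →
    sumℤ (map g xs) ℤ.+ + ∑ xs (λ x → ⟦ not (isPlus (g x)) ⟧) ≡ + ∑ xs (λ x → ⟦ isPlus (g x) ⟧)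
  signed-sum g ±1 [] = refl
  signed-sum g ±1 (x ∷ xs) with g x | ±1 x
  ... | _ | inj₁ refl = trans (plus-term (sumℤ (map g xs)) _) (cong (ℤ._+_ (+ 1)) (signed-sum g ±1 xs))
    where
      plus-term : ∀ S C → (+ 1 ℤ.+ S) ℤ.+ C ≡ + 1 ℤ.+ (S ℤ.+ C)
      plus-term = solve-∀
  ... | _ | inj₂ refl = trans (minus-term (sumℤ (map g xs)) _) (signed-sum g ±1 xs)
    where
      minus-term : ∀ S C → (ℤ.- + 1 ℤ.+ S) ℤ.+ (+ 1 ℤ.+ C) ≡ S ℤ.+ C
      minus-term = solve-∀

module SignedTotalDomination {n : ℕ} (G : Graph n) (simple : IsSimple G) (f : Fin n → ℤ) (stdf : IsSTDF G f) where

  open import Data.Nat using (ℕ; suc; _+_; _*_; _≤_; _<_; ⌊_/2⌋; ⌈_/2⌉)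
  open import Data.Nat.Properties
    using (+-cancelʳ-≤; +-monoˡ-≤; +-monoʳ-<; ≤-trans; ≤-<-trans; +-identityʳ; module ≤-Reasoning)
  open import Data.Nat.Tactic.RingSolver as ℕ-Solver using ()
  import Data.Integer as ℤ
  open import Data.Integer using (+_)
  open import Data.Integer.Properties as ℤP using (drop‿+≤+)
  open import Data.Integer.Tactic.RingSolver as ℤ-Solver using ()
  open import Data.Bool using (Bool; true; false; not)
  open import Data.List using (List; allFin)
  open import Data.Product using (proj₁; proj₂)
  open import Relation.Binary.PropositionalEquality
  open Arithmetic
  open Handshake G simple using (handshake)
  open Signs using (isPlus; signed-sum)

  private
    vs : List (Fin n)
    vs = allFin n

  P : Fin n → Bool
  P v = isPlus (f v)

  pos neg : Fin n → ℕ
  pos v = ∑ (N G v) (λ u → ⟦ P u ⟧)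
  neg v = ∑ (N G v) (λ u → ⟦ not (P u) ⟧)

  p q : ℕ
  p = ∑ vs (λ v → ⟦ P v ⟧)
  q = ∑ vs (λ v → ⟦ not (P v) ⟧)

  degree-split : ∀ v → deg G v ≡ pos v + neg v
  degree-split v = length-partition P (N G v)

  dominated : ∀ v → neg v < pos v
  dominated v = drop‿+≤+ (subst (+ 1 ℤ.+ + neg v ℤ.≤_) (signed-sum f (proj₁ stdf) (N G v))
                                (ℤP.+-monoˡ-≤ (+ neg v) (proj₂ stdf v)))

  order-split : p + q ≡ n
  order-split = trans (sym (length-partition P vs)) (length-allFin n)

  weight-formula : weight f ≡ + p ℤ.- + q
  weight-formula = trans (isolate (weight f) (+ q)) (cong (ℤ._- + q) (signed-sum f (proj₁ stdf) vs))
    where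
      isolate : ∀ w z → w ≡ (w ℤ.+ z) ℤ.- z
      isolate = ℤ-Solver.solve-∀

  -- Both sides count the edges between the +1 and the -1 vertices.
  cross-edges : ∑ vs (λ v → ⟦ P v ⟧ * neg v) ≡ ∑ vs (λ v → ⟦ not (P v) ⟧ * pos v)
  cross-edges = begin
      ∑ vs (λ v → ⟦ P v ⟧ * neg v)
    ≡⟨ ∑-cong vs (λ v → spread ⟦ P v ⟧ (λ u → ⟦ not (P u) ⟧) v) ⟩
      ∑ vs (λ v → ∑ vs (λ u → ⟦ P v ⟧ * (⟦ G v u ⟧ * ⟦ not (P u) ⟧)))
    ≡⟨ ∑-cong vs (λ v → ∑-cong vs (λ u → reverse v u)) ⟩
      ∑ vs (λ v → ∑ vs (λ u → ⟦ not (P u) ⟧ * (⟦ G u v ⟧ * ⟦ P v ⟧)))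
    ≡⟨ ∑-swap vs vs (λ v u → ⟦ not (P u) ⟧ * (⟦ G u v ⟧ * ⟦ P v ⟧)) ⟩
      ∑ vs (λ u → ∑ vs (λ v → ⟦ not (P u) ⟧ * (⟦ G u v ⟧ * ⟦ P v ⟧)))
    ≡⟨ ∑-cong vs (λ u → sym (spread ⟦ not (P u) ⟧ (λ v → ⟦ P v ⟧) u)) ⟩
      ∑ vs (λ u → ⟦ not (P u) ⟧ * pos u) ∎
    where
      open ≡-Reasoning
      spread : ∀ k g v → k * ∑ (N G v) g ≡ ∑ vs (λ u → k * (⟦ G v u ⟧ * g u))
      spread k g v = trans (cong (k *_) (∑-filter (G v) vs g)) (sym (∑-* vs k _))
      rotate : ∀ x y z → x * (y * z) ≡ z * (y * x)
      rotate = ℕ-Solver.solve-∀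
      reverse : ∀ v u → ⟦ P v ⟧ * (⟦ G v u ⟧ * ⟦ not (P u) ⟧) ≡ ⟦ not (P u) ⟧ * (⟦ G u v ⟧ * ⟦ P v ⟧)
      reverse v u = trans (rotate ⟦ P v ⟧ ⟦ G v u ⟧ ⟦ not (P u) ⟧)
                          (cong (λ β → ⟦ not (P u) ⟧ * (⟦ β ⟧ * ⟦ P v ⟧)) (proj₁ simple v u))

  -- If every +1 vertex satisfies A v + kp + c · neg v ≤ B v + lp and every -1
  -- vertex satisfies A v + kq ≤ B v + c · pos v, then summing over all vertices the c-terms on
  -- the two sides both count the edges between P and M (cross-edges) and cancel.
  discharge : (A B : Fin n → ℕ) (kp kq lp c : ℕ)
    → (∀ v → P v ≡ true → A v + kp + c * neg v ≤ B v + lp)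
    → (∀ v → P v ≡ false → A v + kq ≤ B v + c * pos v)
    → ∑ vs A + kp * p + kq * q ≤ ∑ vs B + lp * p
  discharge A B kp kq lp c plus minus = +-cancelʳ-≤ (c * crossing) _ _ (begin
      ∑ vs A + kp * p + kq * q + c * crossing
    ≡⟨ sym left-sum ⟩
      ∑ vs (λ v → A v + kp * ⟦ P v ⟧ + kq * ⟦ not (P v) ⟧ + c * (⟦ P v ⟧ * neg v))
    ≤⟨ ∑-mono vs (λ v → by-sign (P v) {A v} {B v} {kp} {kq} {lp} {c} (plus v) (minus v)) ⟩
      ∑ vs (λ v → B v + lp * ⟦ P v ⟧ + c * (⟦ not (P v) ⟧ * pos v))
    ≡⟨ right-sum ⟩
      ∑ vs B + lp * p + c * crossing ∎)
    where
      open ≤-Reasoning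
      crossing : ℕ
      crossing = ∑ vs (λ v → ⟦ P v ⟧ * neg v)
      left-sum : ∑ vs (λ v → A v + kp * ⟦ P v ⟧ + kq * ⟦ not (P v) ⟧ + c * (⟦ P v ⟧ * neg v))
               ≡ ∑ vs A + kp * p + kq * q + c * crossing
      left-sum = trans (∑-+* vs _ c _) (cong (_+ c * crossing)
                   (trans (∑-+* vs _ kq _) (cong (_+ kq * q) (∑-+* vs A kp _))))
      right-sum : ∑ vs (λ v → B v + lp * ⟦ P v ⟧ + c * (⟦ not (P v) ⟧ * pos v))
                ≡ ∑ vs B + lp * p + c * crossing
      right-sum = trans (∑-+* vs _ c _) (cong₂ _+_ (∑-+* vs B lp _) (cong (c *_) (sym cross-edges)))

  module Counting (δ Δ : ℕ) (δ≤deg : ∀ v → δ ≤ deg G v) (deg≤Δ : ∀ v → deg G v ≤ Δ) where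

    -- 2 · neg v < pos v + neg v = deg v ≤ Δ.
    neg<⌈Δ/2⌉ : ∀ v → neg v < ⌈ Δ /2⌉
    neg<⌈Δ/2⌉ v = <⌈/2⌉ (≤-trans (+-monoˡ-≤ (neg v) (dominated v)) (subst (_≤ Δ) (degree-split v) (deg≤Δ v)))

    -- δ ≤ deg v = pos v + neg v < 2 · pos v.
    ⌊δ/2⌋<pos : ∀ v → ⌊ δ /2⌋ < pos v
    ⌊δ/2⌋<pos v = ⌊/2⌋< (≤-<-trans (subst (δ ≤_) (degree-split v) (δ≤deg v)) (+-monoʳ-< (pos v) (dominated v)))

    parity : ∀ v → neg v + 1 + ev (deg G v) ≤ pos v
    parity v = subst (λ d → neg v + 1 + ev d ≤ pos v) (sym (degree-split v)) (parity-gap (dominated v))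

    ∑ev : ∑ vs (λ v → ev (deg G v)) ≡ nEven G
    ∑ev = sym (length-filter _ vs)

    -- Bound (i): each -1 vertex has more than ⌊δ/2⌋ neighbours in P and each +1 vertex fewer
    -- than ⌈Δ/2⌉ in M, so (1 + ⌊δ/2⌋) q ≤ (edges between P and M) ≤ (⌈Δ/2⌉ - 1) p.
    count₁ : 1 * p + (1 + ⌊ δ /2⌋) * q ≤ ⌈ Δ /2⌉ * p
    count₁ = subst (λ s → s + 1 * p + (1 + ⌊ δ /2⌋) * q ≤ s + ⌈ Δ /2⌉ * p) (∑-zero vs)
      (discharge (λ _ → 0) (λ _ → 0) 1 (1 + ⌊ δ /2⌋) ⌈ Δ /2⌉ 1
        (λ v _ → subst (λ k → suc k ≤ ⌈ Δ /2⌉) (sym (+-identityʳ (neg v))) (neg<⌈Δ/2⌉ v))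
        (λ v _ → subst (suc ⌊ δ /2⌋ ≤_) (sym (+-identityʳ (pos v))) (⌊δ/2⌋<pos v)))

    count₂ : 2 * (2 * size G) + nEven G + 3 * p + 2 * q ≤ (3 * Δ + 2 * ⌈ Δ /2⌉) * p
    count₂ = subst₂ (λ s t → s + 3 * p + 2 * q ≤ t + (3 * Δ + 2 * ⌈ Δ /2⌉) * p) ∑A (∑-zero vs)
      (discharge (λ v → 2 * deg G v + ev (deg G v)) (λ _ → 0) 3 2 (3 * Δ + 2 * ⌈ Δ /2⌉) 4
        (λ v _ → plus₂ (degree-split v) (parity v) (deg≤Δ v) (neg<⌈Δ/2⌉ v))
        (λ v _ → minus₂ (degree-split v) (parity v)))
      where
        ∑A : ∑ vs (λ v → 2 * deg G v + ev (deg G v)) ≡ 2 * (2 * size G) + nEven G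
        ∑A = trans (∑-+ vs _ _) (cong₂ _+_ (trans (∑-* vs 2 (deg G)) (cong (2 *_) handshake)) ∑ev)

    count₃ : nEven G + 3 * p + (3 * δ + 2) * q ≤ 2 * size G + 2 * ⌈ Δ /2⌉ * p
    count₃ = subst₂ (λ s t → s + 3 * p + (3 * δ + 2) * q ≤ t + 2 * ⌈ Δ /2⌉ * p) ∑ev handshake
      (discharge (λ v → ev (deg G v)) (deg G) 3 (3 * δ + 2) (2 * ⌈ Δ /2⌉) 4
        (λ v _ → plus₃ (degree-split v) (parity v) (neg<⌈Δ/2⌉ v))
        (λ v _ → minus₃ (degree-split v) (parity v) (δ≤deg v)))

module Cycle where

  open import Data.Nat using (ℕ; zero; suc; pred; _+_; _*_; _≤_; _<_; z≤n; s≤s; _≡ᵇ_)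
  open import Data.Nat.Properties
    using (≡ᵇ⇒≡; ≡⇒≡ᵇ; ≤-trans; ≤-refl; ≤-reflexive; <-irrefl; ≤∧≢⇒<; n<1+n; n≤1+n; *-cancelˡ-≡)
  open import Data.Bool using (Bool; true; false; _∧_; _∨_; T; if_then_else_)
  open import Data.Bool.Properties using (∨-comm; ∨-identityʳ; ∧-identityʳ; ∧-zeroʳ)
  open import Data.Unit using (tt)
  open import Data.List using (List; allFin)
  open import Data.Fin using (Fin; toℕ; fromℕ<)
  open import Data.Fin.Properties using (toℕ<n)
  open import Data.Product using (_,_)
  open import Data.Empty using (⊥)
  open import Relation.Binary.PropositionalEquality
  open import Relation.Nullary using (contradiction)
  open Arithmetic using (ev)

  next : ℕ → ℕ → ℕ
  next n i = if suc i ≡ᵇ n then 0 else suc i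

  prev : ℕ → ℕ → ℕ
  prev n zero = pred n
  prev n (suc i) = i

  ≡ᵇ-sym : ∀ a b → (a ≡ᵇ b) ≡ (b ≡ᵇ a)
  ≡ᵇ-sym zero zero = refl
  ≡ᵇ-sym zero (suc b) = refl
  ≡ᵇ-sym (suc a) zero = refl
  ≡ᵇ-sym (suc a) (suc b) = ≡ᵇ-sym a b

  ≡ᵇ-true : ∀ a b → (a ≡ᵇ b) ≡ true → a ≡ b
  ≡ᵇ-true a b eq = ≡ᵇ⇒≡ a b (subst T (sym eq) tt)

  ≡ᵇ-false : ∀ a b → a ≢ b → (a ≡ᵇ b) ≡ false
  ≡ᵇ-false a b a≢b with a ≡ᵇ b in eq
  ... | true = contradiction (≡ᵇ-true a b eq) a≢b
  ... | false = refl

  follows-next : ∀ n i j → j < n → ((suc i ≡ᵇ j) ∨ ((suc i ≡ᵇ n) ∧ (j ≡ᵇ 0))) ≡ (j ≡ᵇ next n i)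
  follows-next n i j j<n with suc i ≡ᵇ n in wraps
  ... | true with suc i ≡ᵇ j in hits
  ...   | true = contradiction (subst (_< n) j≡n j<n) (<-irrefl refl)
    where
      j≡n : j ≡ n
      j≡n = trans (sym (≡ᵇ-true (suc i) j hits)) (≡ᵇ-true (suc i) n wraps)
  ...   | false = refl
  follows-next n i j j<n | false = trans (∨-identityʳ (suc i ≡ᵇ j)) (≡ᵇ-sym (suc i) j)

  precedes-prev : ∀ n i j → 1 ≤ n → ((suc j ≡ᵇ i) ∨ ((suc j ≡ᵇ n) ∧ (i ≡ᵇ 0))) ≡ (j ≡ᵇ prev n i)
  precedes-prev (suc n) zero j _ = ∧-identityʳ (j ≡ᵇ n)
  precedes-prev n (suc i) j _ rewrite ∧-zeroʳ (suc j ≡ᵇ n) = ∨-identityʳ (j ≡ᵇ i)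

  next<n : ∀ n i → i < n → next n i < n
  next<n n i i<n with suc i ≡ᵇ n in wraps
  ... | true = ≤-trans (s≤s z≤n) i<n
  ... | false = ≤∧≢⇒< i<n (λ eq → subst T wraps (≡⇒≡ᵇ (suc i) n eq))

  prev<n : ∀ n i → i < n → prev n i < n
  prev<n (suc n) zero _ = n<1+n n
  prev<n n (suc i) i+1<n = ≤-trans (n≤1+n (suc i)) i+1<n

  next≢self : ∀ n i → 3 ≤ n → next n i ≢ i
  next≢self n i 3≤n eq with suc i ≡ᵇ n in wraps
  ... | true = too-short (subst (3 ≤_) (trans (sym (≡ᵇ-true (suc i) n wraps)) (cong suc (sym eq))) 3≤n)
    where
      too-short : 3 ≤ 1 → ⊥
      too-short (s≤s ())
  ... | false = <-irrefl (sym eq) ≤-refl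

  next≢prev : ∀ n i → 3 ≤ n → next n i ≢ prev n i
  next≢prev zero i () eq
  next≢prev (suc zero) i (s≤s ()) eq
  next≢prev (suc (suc zero)) i (s≤s (s≤s ())) eq
  next≢prev (suc (suc (suc k))) i _ eq with suc i ≡ᵇ suc (suc (suc k)) in wraps
  next≢prev (suc (suc (suc k))) zero _ eq | true with () ← ≡ᵇ-true 1 (suc (suc (suc k))) wraps
  next≢prev (suc (suc (suc k))) (suc zero) _ eq | true with () ← ≡ᵇ-true 2 (suc (suc (suc k))) wraps
  next≢prev (suc (suc (suc k))) (suc (suc i)) _ () | true
  next≢prev (suc (suc (suc k))) zero _ () | false
  next≢prev (suc (suc (suc k))) (suc i) _ eq | false = <-irrefl (sym eq) (n≤1+n (suc i))

  index-unique : ∀ n k → k < n → ∑ (allFin n) (λ u → ⟦ toℕ u ≡ᵇ k ⟧) ≡ 1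
  index-unique (suc n) zero _ = trans (∑-allFin-suc n (λ u → ⟦ toℕ u ≡ᵇ 0 ⟧)) (cong suc (∑-zero (allFin n)))
  index-unique (suc n) (suc k) (s≤s k<n) = trans (∑-allFin-suc n (λ u → ⟦ toℕ u ≡ᵇ suc k ⟧)) (index-unique n k k<n)

  disjoint-or : ∀ x y → (x ≡ true → y ≡ true → ⊥) → ⟦ x ∨ y ⟧ ≡ ⟦ x ⟧ + ⟦ y ⟧
  disjoint-or true true both = contradiction refl (λ x → both x refl)
  disjoint-or true false _ = refl
  disjoint-or false y _ = refl

  module _ (n : ℕ) (3≤n : 3 ≤ n) where

    private
      vs : List (Fin n)
      vs = allFin n

    cycle-adjacency : ∀ v u → cycle n v u ≡ (toℕ u ≡ᵇ next n (toℕ v)) ∨ (toℕ u ≡ᵇ prev n (toℕ v))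
    cycle-adjacency v u = cong₂ _∨_ (follows-next n (toℕ v) (toℕ u) (toℕ<n u))
                                   (precedes-prev n (toℕ v) (toℕ u) (≤-trans (s≤s z≤n) 3≤n))

    cycle-simple : IsSimple (cycle n)
    cycle-simple = (λ u v → ∨-comm (succAdj n u v) (succAdj n v u)) , loopless
      where
        loopless : ∀ v → cycle n v v ≡ false
        loopless v rewrite follows-next n (toℕ v) (toℕ v) (toℕ<n v)
                         | ≡ᵇ-false (toℕ v) (next n (toℕ v)) (λ eq → next≢self n (toℕ v) 3≤n (sym eq)) = refl

    cycle-degree : ∀ v → deg (cycle n) v ≡ 2
    cycle-degree v = begin
        deg (cycle n) v
      ≡⟨ length-filter (cycle n v) vs ⟩
        ∑ vs (λ u → ⟦ cycle n v u ⟧)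
      ≡⟨ ∑-cong vs (λ u → trans (cong ⟦_⟧ (cycle-adjacency v u)) (disjoint-or _ _ (not-both u))) ⟩
        ∑ vs (λ u → ⟦ toℕ u ≡ᵇ next n i ⟧ + ⟦ toℕ u ≡ᵇ prev n i ⟧)
      ≡⟨ ∑-+ vs _ _ ⟩
        ∑ vs (λ u → ⟦ toℕ u ≡ᵇ next n i ⟧) + ∑ vs (λ u → ⟦ toℕ u ≡ᵇ prev n i ⟧)
      ≡⟨ cong₂ _+_ (index-unique n _ (next<n n i (toℕ<n v))) (index-unique n _ (prev<n n i (toℕ<n v))) ⟩
        2 ∎
      where
        open ≡-Reasoning
        i : ℕ
        i = toℕ v
        not-both : ∀ u → (toℕ u ≡ᵇ next n i) ≡ true → (toℕ u ≡ᵇ prev n i) ≡ true → ⊥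
        not-both u is-next is-prev =
          next≢prev n i 3≤n (trans (sym (≡ᵇ-true (toℕ u) _ is-next)) (≡ᵇ-true (toℕ u) _ is-prev))

    cycle-min-degree : IsMinDegree (cycle n) 2
    cycle-min-degree = (fromℕ< (≤-trans (s≤s z≤n) 3≤n) , cycle-degree _) , (λ v → ≤-reflexive (sym (cycle-degree v)))

    cycle-max-degree : IsMaxDegree (cycle n) 2
    cycle-max-degree = (fromℕ< (≤-trans (s≤s z≤n) 3≤n) , cycle-degree _) , (λ v → ≤-reflexive (cycle-degree v))

    ∑-ones : ∑ vs (λ _ → 1) ≡ n
    ∑-ones = trans (sym (length≡∑1 vs)) (length-allFin n)

    cycle-nEven : nEven (cycle n) ≡ n
    cycle-nEven = trans (length-filter _ vs) (trans (∑-cong vs (λ v → cong ev (cycle-degree v))) ∑-ones)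

    cycle-size : size (cycle n) ≡ n
    cycle-size = *-cancelˡ-≡ (size (cycle n)) n 2 (begin
        2 * size (cycle n)     ≡⟨ sym (Handshake.handshake (cycle n) cycle-simple) ⟩
        ∑ vs (deg (cycle n))   ≡⟨ ∑-cong vs cycle-degree ⟩
        ∑ vs (λ _ → 2 * 1)     ≡⟨ ∑-* vs 2 (λ _ → 1) ⟩
        2 * ∑ vs (λ _ → 1)     ≡⟨ cong (2 *_) ∑-ones ⟩
        2 * n                  ∎)
      where open ≡-Reasoning

open import Data.Nat using (⌊_/2⌋; ⌈_/2⌉; z≤n; s≤s)
open import Data.Nat.Properties using (≤-reflexive)
open import Data.Integer using (+_; _+_; _-_; _*_; _≤_; +≤+)
open import Data.Integer.Properties using (*-cancelʳ-≤-pos)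
open import Data.Integer.Tactic.RingSolver using (solve-∀)
open import Data.List using (List; []; _∷_; map; length; allFin)
open import Data.Product using (_×_; _,_; proj₁; proj₂)
open import Data.Sum using (inj₁)
open import Relation.Binary.PropositionalEquality using (_≡_; refl; sym; trans; cong; subst)
open Rearrangement using (Bound₁; Bound₂; Bound₃; bound₁; bound₂; bound₃)
open Cycle using (cycle-simple; cycle-degree; cycle-min-degree; cycle-max-degree; cycle-nEven; cycle-size)

lower-bounds : ∀ {n} (G : Graph n) (δ Δ : ℕ) {f : Fin n → ℤ} {γ : ℤ} → IsSimple G
  → (∀ v → δ Data.Nat.≤ deg G v) → (∀ v → deg G v Data.Nat.≤ Δ) → IsSTDF G f → weight f ≡ γ
  → Bound₁ n δ Δ γ × Bound₂ n Δ (nEven G) (size G) γ × Bound₃ n δ Δ (nEven G) (size G) γ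
lower-bounds G δ Δ {f} simple δ≤deg deg≤Δ stdf refl =
    bound₁ {⌊ δ /2⌋} {⌈ Δ /2⌉} {p} {q} order-split weight-formula count₁
  , bound₂ {Δ} {⌈ Δ /2⌉} {p} {q} {size G} {nEven G} order-split weight-formula count₂
  , bound₃ {δ} {⌈ Δ /2⌉} {p} {q} {size G} {nEven G} order-split weight-formula count₃
  where
    open SignedTotalDomination G simple f stdf
    open Counting δ Δ δ≤deg deg≤Δ

-- γ_st(C_n) = n: the all-ones function is an STDF of weight n, and by bound (i) with
-- δ = Δ = 2 no STDF weighs less.
cycle-γ : ∀ n → 3 Data.Nat.≤ n → IsγST (cycle n) (+ n)
cycle-γ n 3≤n = (ones , ones-stdf , ones-weight) , minimal
  where
    ones : Fin n → ℤ
    ones _ = + 1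
    ones-sum : ∀ {A : Set} (xs : List A) → sumℤ (map (λ _ → + 1) xs) ≡ + length xs
    ones-sum [] = refl
    ones-sum (_ ∷ xs) = cong (_+_ (+ 1)) (ones-sum xs)
    ones-stdf : IsSTDF (cycle n) ones
    ones-stdf = (λ _ → inj₁ refl)
              , (λ v → subst (+ 1 ≤_) (sym (trans (ones-sum (N (cycle n) v)) (cong +_ (cycle-degree n 3≤n v))))
                             (+≤+ (s≤s z≤n)))
    ones-weight : weight ones ≡ + n
    ones-weight = trans (ones-sum (allFin n)) (cong +_ (length-allFin n))
    two-n : ∀ x → (+ 1 - + 1 + + 2) * x ≡ x * + 2
    two-n = solve-∀
    minimal : ∀ f → IsSTDF (cycle n) f → + n ≤ weight f
    minimal f stdf = *-cancelʳ-≤-pos (+ n) (weight f) (+ 2) (subst (_≤ weight f * + 2) (two-n (+ n))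
      (proj₁ (lower-bounds (cycle n) 2 2 (cycle-simple n 3≤n) (λ v → ≤-reflexive (sym (cycle-degree n 3≤n v)))
                           (λ v → ≤-reflexive (cycle-degree n 3≤n v)) stdf refl)))

cycle-tight : ∀ n → 3 Data.Nat.≤ n
  → ((+ ⌊ 2 /2⌋ - + ⌈ 2 /2⌉ + + 2) * + n ≡ + n * + (⌊ 2 /2⌋ Data.Nat.+ ⌈ 2 /2⌉))
  × ((+ 5 - + 3 * + 2 - + 2 * + ⌈ 2 /2⌉) * + n + + 2 * + nEven (cycle n) + + 8 * + size (cycle n)
       ≡ + n * (+ 3 * + 2 + + 2 * + ⌈ 2 /2⌉ - + 1))
  × ((+ 5 + + 3 * + 2 - + 2 * + ⌈ 2 /2⌉) * + n + + 2 * + nEven (cycle n) - + 4 * + size (cycle n)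
       ≡ + n * (+ 3 * + 2 + + 2 * + ⌈ 2 /2⌉ - + 1))
cycle-tight n 3≤n rewrite cycle-nEven n 3≤n | cycle-size n 3≤n = tight₁ (+ n) , tight₂ (+ n) , tight₃ (+ n)
  where
    tight₁ : ∀ x → (+ 1 - + 1 + + 2) * x ≡ x * + (1 Data.Nat.+ 1)
    tight₁ = solve-∀
    tight₂ : ∀ x → (+ 5 - + 3 * + 2 - + 2 * + 1) * x + + 2 * x + + 8 * x ≡ x * (+ 3 * + 2 + + 2 * + 1 - + 1)
    tight₂ = solve-∀
    tight₃ : ∀ x → (+ 5 + + 3 * + 2 - + 2 * + 1) * x + + 2 * x - + 4 * x ≡ x * (+ 3 * + 2 + + 2 * + 1 - + 1)
    tight₃ = solve-∀

theorem3p2 :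
    (∀ (n : ℕ) (G : Graph n) (δ Δ : ℕ) (γ : ℤ) → 1 Data.Nat.≤ n → IsSimple G → NoIsolated G
      → IsMinDegree G δ → IsMaxDegree G Δ → IsγST G γ
      → ((+ ⌊ δ /2⌋ - + ⌈ Δ /2⌉ + + 2) * + n ≤ γ * + (⌊ δ /2⌋ Data.Nat.+ ⌈ Δ /2⌉))
      × ((+ 5 - + 3 * + Δ - + 2 * + ⌈ Δ /2⌉) * + n + + 2 * + nEven G + + 8 * + size G
           ≤ γ * (+ 3 * + Δ + + 2 * + ⌈ Δ /2⌉ - + 1))
      × ((+ 5 + + 3 * + δ - + 2 * + ⌈ Δ /2⌉) * + n + + 2 * + nEven G - + 4 * + size G
           ≤ γ * (+ 3 * + δ + + 2 * + ⌈ Δ /2⌉ - + 1)))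
    × (∀ (n : ℕ) → 3 Data.Nat.≤ n →
         IsSimple (cycle n) × NoIsolated (cycle n) × IsMinDegree (cycle n) 2 × IsMaxDegree (cycle n) 2
         × IsγST (cycle n) (+ n)
         × ((+ ⌊ 2 /2⌋ - + ⌈ 2 /2⌉ + + 2) * + n ≡ + n * + (⌊ 2 /2⌋ Data.Nat.+ ⌈ 2 /2⌉))
         × ((+ 5 - + 3 * + 2 - + 2 * + ⌈ 2 /2⌉) * + n + + 2 * + nEven (cycle n) + + 8 * + size (cycle n)
              ≡ + n * (+ 3 * + 2 + + 2 * + ⌈ 2 /2⌉ - + 1))
         × ((+ 5 + + 3 * + 2 - + 2 * + ⌈ 2 /2⌉) * + n + + 2 * + nEven (cycle n) - + 4 * + size (cycle n)
              ≡ + n * (+ 3 * + 2 + + 2 * + ⌈ 2 /2⌉ - + 1)))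
theorem3p2 =
    (λ n G δ Δ γ _ simple _ min-δ max-Δ ((f , stdf , weight≡γ) , _) →
       lower-bounds G δ Δ simple (proj₂ min-δ) (proj₂ max-Δ) stdf weight≡γ)
  , (λ n 3≤n →
       cycle-simple n 3≤n
     , (λ v → subst (1 Data.Nat.≤_) (sym (cycle-degree n 3≤n v)) (s≤s z≤n))
     , cycle-min-degree n 3≤n
     , cycle-max-degree n 3≤n
     , cycle-γ n 3≤n
     , cycle-tight n 3≤n)
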